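{- Let $n>1$, let $D'\in\mathcal{T}_{n-1}$ and $b\in V(D')$. Let $D$ be the digraph with $V(D)=V(D')\cup\{a\}$ ($a$ a new vertex) whose arc set is given by one of the following rules: (i) if $b$ is domination-forced in $D'$, then $A(D)=A(D')\cup\{ba,aa\}$; (ii) if $b$ has no loop, $d^+_{D'}(f^-_{D'}(b))=1$ and $f^-_{D'}(b)$ is domination-forced in $D'$, then $A(D)=A(D')\cup\{ab,aa\}$. Then $D\in\mathcal{T}_n$.
   Context: Digraphs are finite and may contain loops ($aa$ denotes a loop at $a$); for each ordered pair $(x,y)$ there is at most one arc $xy$. $N^-(v)$ (resp. $N^+(v)$) is the set of vertices $u$ with $uv$ (resp. $vu$) an arc, including $v$ if $v$ has a loop; $d^+(v)=|N^+(v)|$. An OLD set of $D$ is a set $S\subseteq V(D)$ such that every vertex has an in-neighbour in $S$ and for every two distinct vertices $u,v$, some vertex of $S$ lies in $N^-(u)\ominus N^-(v)$. $D$ is locatable if it admits an OLD set; $\gamma_{OL}(D)$ is the minimum size of an OLD set. A vertex $v$ is domination-forced if some vertex $w$ has $N^-(w)=\{v\}$. An arc $xy$ (possibly a loop) is forcing if $N^-(y)=\{x\}$ or there is a vertex $z$ with $N^-(y)\ominus N^-(z)=\{x\}$. In a locatable digraph $D'$ of order $m$ with $\gamma_{OL}(D')=m$, every vertex $v$ has exactly one incoming forcing arc; $f^-_{D'}(v)$ denotes its tail. The underlying graph is the simple undirected graph with $x\neq y$ adjacent iff $xy$ or $yx$ is an arc. $\mathcal{T}_m$ is the set of locatable digraphs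 $D$ of order $m$ with $\gamma_{OL}(D)=m$ whose underlying graph is a tree. -}

module Defs where

open import Data.Nat using (ℕ; zero; suc; _≤_)
open import Data.Fin using (Fin; zero; suc; _≟_)
open import Data.Fin.Subset using (Subset; _∈_; ∣_∣)
open import Data.Vec using (tabulate)
open import Data.Bool using (Bool; true; false; _xor_)
open import Data.List using (List; []; _∷_)
open import Data.List.Relation.Unary.Unique.Propositional using (Unique)
open import Data.Product using (Σ; ∃; _×_)
open import Data.Sum using (_⊎_)
open import Data.Unit using (⊤)
open import Data.Empty using (⊥)
open import Relation.Nullary using (¬_; ⌊_⌋)
open import Relation.Binary.PropositionalEquality using (_≡_; _≢_)
open import Function.Bundles using (_⇔_)

-- A digraph on vertex set Fin m (loops allowed, at most one arc per ordered pair):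
-- D x y ≡ true  iff  xy is an arc.
Digraph : ℕ → Set
Digraph m = Fin m → Fin m → Bool

module _ {m : ℕ} (D : Digraph m) where

  -- u ∈ N⁻(v)  iff  D u v ≡ true.
  -- OLD set: every vertex has an in-neighbour in S, and any two distinct
  -- vertices are separated by some vertex of S in N⁻(u) ⊖ N⁻(v).
  IsOLD : Subset m → Set
  IsOLD S =
    (∀ v → ∃ λ u → u ∈ S × D u v ≡ true) ×
    (∀ u v → u ≢ v → ∃ λ w → w ∈ S × (D w u xor D w v) ≡ true)

  Locatable : Set
  Locatable = ∃ λ S → IsOLD S

  γOL≡ : ℕ → Set
  γOL≡ k = (∃ λ S → IsOLD S × ∣ S ∣ ≡ k) × (∀ S → IsOLD S → k ≤ ∣ S ∣)

  outdeg : Fin m → ℕ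
  outdeg v = ∣ tabulate (D v) ∣

  DomForced : Fin m → Set
  DomForced v = ∃ λ w → ∀ u → (D u w ≡ true) ⇔ (u ≡ v)

  ForcingArc : Fin m → Fin m → Set
  ForcingArc x y = D x y ≡ true ×
    ((∀ u → (D u y ≡ true) ⇔ (u ≡ x)) ⊎
     (∃ λ z → ∀ u → ((D u y xor D u z) ≡ true) ⇔ (u ≡ x)))

  Adj : Fin m → Fin m → Set
  Adj x y = x ≢ y × (D x y ≡ true ⊎ D y x ≡ true)

  Chain : List (Fin m) → Set
  Chain [] = ⊤
  Chain (x ∷ []) = ⊤
  Chain (x ∷ y ∷ xs) = Adj x y × Chain (y ∷ xs)

  data EndsIn : List (Fin m) → Fin m → Set where
    here  : ∀ y → EndsIn (y ∷ []) y
    there : ∀ {x xs y} → EndsIn xs y → EndsIn (x ∷ xs) y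

  Connected : Set
  Connected = ∀ x y → ∃ λ xs → Chain (x ∷ xs) × EndsIn (x ∷ xs) y

  IsCycle : List (Fin m) → Set
  IsCycle [] = ⊥
  IsCycle (x ∷ []) = ⊥
  IsCycle (x ∷ y ∷ []) = ⊥
  IsCycle (x ∷ y ∷ z ∷ zs) =
    Unique (x ∷ y ∷ z ∷ zs) × Chain (x ∷ y ∷ z ∷ zs) ×
    (∃ λ w → EndsIn (z ∷ zs) w × Adj w x)

  Acyclic : Set
  Acyclic = ∀ cs → ¬ IsCycle cs

  UnderlyingTree : Set
  UnderlyingTree = Connected × Acyclic

InT : (m : ℕ) → Digraph m → Set
InT m D = Locatable D × γOL≡ D m × UnderlyingTree D

-- new vertex a is represented by zero, old vertex x of D' by suc x.
-- rule (i): A(D) = A(D') ∪ {ba, aa}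
ruleI : ∀ {k} → Digraph k → Fin k → Digraph (suc k)
ruleI D' b zero    zero    = true
ruleI D' b (suc x) zero    = ⌊ x ≟ b ⌋
ruleI D' b zero    (suc y) = false
ruleI D' b (suc x) (suc y) = D' x y

ruleII : ∀ {k} → Digraph k → Fin k → Digraph (suc k)
ruleII D' b zero    zero    = true
ruleII D' b (suc x) zero    = false
ruleII D' b zero    (suc y) = ⌊ y ≟ b ⌋
ruleII D' b (suc x) (suc y) = D' x y

{-# OPTIONS --safe #-}
-- In both rules the new vertex a is a pendant vertex of the underlying tree, so D is again a
-- tree, and the whole vertex set is OLD in D. Every OLD set S of D must contain a, and
-- S ∖ {a} is an OLD set of D' (in rule II the vertex x = f⁻(b) lies in S and takes over the
-- role of a, because N⁺(x) = {b}); hence |S| ≥ 1 + γ_OL(D') = n.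
module Submission where

open import Defs
open import Data.Nat using (ℕ; suc; _≤_; _<_; s≤s)
open import Data.Nat.Properties using (≤⇒≯)
open import Data.Fin using (Fin; zero; suc; _≟_)
open import Data.Fin.Properties using (suc-injective)
open import Data.Fin.Subset using (Subset; _∈_; _⊆_; ⊤; ⁅_⁆; _-_; ∣_∣)
open import Data.Fin.Subset.Properties
  using (∈⊤; ∣⊤∣≡n; ∣⁅x⁆∣≡1; x∈⁅y⁆⇒x≡y; x∈p∧x≢y⇒x∈p-y; x∈p⇒∣p-x∣<∣p∣; p⊆q⇒∣p∣≤∣q∣)
open import Data.Vec using (tabulate; _∷_; here; there)
open import Data.Vec.Properties using (lookup∘tabulate; lookup⇒[]=)
open import Data.Bool using (Bool; true; false; not; _xor_)
open import Data.Bool.Properties using (T-≡; ¬-not; not-¬; xor-comm; xor-same)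
open import Data.List using (List; []; _∷_; map)
open import Data.List.Relation.Unary.All as All using (_∷_)
open import Data.List.Relation.Unary.AllPairs using (_∷_)
open import Data.List.Relation.Unary.Any using (here; there; any?)
open import Data.List.Relation.Unary.Unique.Propositional using (Unique)
open import Data.List.Relation.Unary.Unique.Propositional.Properties using (map⁻)
open import Data.List.Membership.Propositional using () renaming (_∈_ to _∈ₗ_; _∉_ to _∉ₗ_)
open import Data.Product using (∃; ∃₂; _×_; _,_)
open import Data.Sum using (inj₁; inj₂; swap)
open import Data.Unit using (tt)
open import Function using (_∘_)
open import Function.Bundles using (_⇔_; mk⇔; Equivalence)
open import Relation.Nullary using (⌊_⌋; yes; no; contradiction)
open import Relation.Nullary.Decidable using (toWitness; fromWitness; isYes≗does; dec-false)
open import Relation.Binary.PropositionalEquality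
  using (_≡_; _≢_; refl; sym; trans; cong; cong₂; subst)

module _ {n : ℕ} {x y : Fin n} where

  ⌊≟⌋≡true⇒≡ : ⌊ x ≟ y ⌋ ≡ true → x ≡ y
  ⌊≟⌋≡true⇒≡ e = toWitness (Equivalence.from T-≡ e)

  ≡⇒⌊≟⌋≡true : x ≡ y → ⌊ x ≟ y ⌋ ≡ true
  ≡⇒⌊≟⌋≡true e = Equivalence.to T-≡ (fromWitness e)

  ≢⇒⌊≟⌋≡false : x ≢ y → ⌊ x ≟ y ⌋ ≡ false
  ≢⇒⌊≟⌋≡false x≢y = trans (isYes≗does (x ≟ y)) (dec-false (x ≟ y) x≢y)

indicator-of-singleton : ∀ {n} {f : Fin n → Bool} {c} →
  (∀ u → (f u ≡ true) ⇔ (u ≡ c)) → ∀ u → f u ≡ ⌊ u ≟ c ⌋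
indicator-of-singleton {c = c} f⇔ u with u ≟ c
... | yes u≡c = Equivalence.from (f⇔ u) u≡c
... | no  u≢c = ¬-not (u≢c ∘ Equivalence.to (f⇔ u))

∣p∣≡1⇒∈-unique : ∀ {n} {p : Subset n} {x y} → ∣ p ∣ ≡ 1 → x ∈ p → y ∈ p → x ≡ y
∣p∣≡1⇒∈-unique {p = p} {x} {y} ∣p∣≡1 x∈p y∈p with x ≟ y
... | yes x≡y = x≡y
... | no  x≢y =
  contradiction (subst (∣ p - x ∣ <_) ∣p∣≡1 (x∈p⇒∣p-x∣<∣p∣ x∈p)) (≤⇒≯ 1≤∣p-x∣)
  where
  ⁅y⁆⊆p-x : ⁅ y ⁆ ⊆ p - x
  ⁅y⁆⊆p-x z∈⁅y⁆ = subst (_∈ p - x) (sym (x∈⁅y⁆⇒x≡y y z∈⁅y⁆)) (x∈p∧x≢y⇒x∈p-y y∈p (x≢y ∘ sym))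

  1≤∣p-x∣ : 1 ≤ ∣ p - x ∣
  1≤∣p-x∣ = subst (_≤ ∣ p - x ∣) (∣⁅x⁆∣≡1 y) (p⊆q⇒∣p∣≤∣q∣ ⁅y⁆⊆p-x)

outdeg≡1⇒out-unique : ∀ {m} (D : Digraph m) {x y z} →
  outdeg D x ≡ 1 → D x y ≡ true → D x z ≡ true → y ≡ z
outdeg≡1⇒out-unique D {x} outdeg≡1 xy xz = ∣p∣≡1⇒∈-unique outdeg≡1 (arc⇒∈ xy) (arc⇒∈ xz)
  where
  arc⇒∈ : ∀ {v} → D x v ≡ true → v ∈ tabulate (D x)
  arc⇒∈ {v} e = lookup⇒[]= v (tabulate (D x)) (trans (lookup∘tabulate (D x) v) e)

module _ {m : ℕ} (D : Digraph m) where

  Dominating : Set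
  Dominating = ∀ v → ∃ λ u → D u v ≡ true

  Separating : Set
  Separating = ∀ u v → u ≢ v → ∃ λ w → (D w u xor D w v) ≡ true

  Locatable⇒Dominating : Locatable D → Dominating
  Locatable⇒Dominating (_ , dom , _) v with dom v
  ... | u , _ , uv = u , uv

  Locatable⇒Separating : Locatable D → Separating
  Locatable⇒Separating (_ , _ , sep) u v u≢v with sep u v u≢v
  ... | w , _ , w-sep = w , w-sep

  ⊤-isOLD : Dominating → Separating → IsOLD D ⊤
  ⊤-isOLD dom sep = (λ v → let u , uv = dom v in u , ∈⊤ , uv)
                  , (λ u v u≢v → let w , w-sep = sep u v u≢v in w , ∈⊤ , w-sep)

  Adj-sym : ∀ {x y} → Adj D x y → Adj D y x
  Adj-sym (x≢y , arc) = x≢y ∘ sym , swap arc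

  Walk : Fin m → Fin m → Set
  Walk x y = ∃ λ xs → Chain D (x ∷ xs) × EndsIn D (x ∷ xs) y

  walk-refl : ∀ x → Walk x x
  walk-refl x = [] , tt , here x

  walk-cons : ∀ {x y z} → Adj D x y → Walk y z → Walk x z
  walk-cons {y = y} xy (xs , chain , ends) = y ∷ xs , (xy , chain) , there ends

  walk-trans : ∀ {x y z} → Walk x y → Walk y z → Walk x z
  walk-trans ([] , _ , here _) w = w
  walk-trans ([] , _ , there ())
  walk-trans (_ ∷ ys , (xy , chain) , there ends) w = walk-cons xy (walk-trans (ys , chain , ends) w)

  EndsIn⇒∈ : ∀ {xs e} → EndsIn D xs e → e ∈ₗ xs
  EndsIn⇒∈ (here _) = here refl
  EndsIn⇒∈ (there ends) = there (EndsIn⇒∈ ends)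

  interior⇒two-neighbours : ∀ a L {v e} → Chain D (a ∷ L) → Unique (a ∷ L) →
    v ∈ₗ L → EndsIn D (a ∷ L) e → v ≢ e → ∃₂ λ p q → p ≢ q × Adj D p v × Adj D q v
  interior⇒two-neighbours a (b ∷ []) _ _ (here refl) (there (here _)) v≢e = contradiction refl v≢e
  interior⇒two-neighbours a (b ∷ []) _ _ (here refl) (there (there ()))
  interior⇒two-neighbours a (b ∷ c ∷ _) (ab , bc , _) ((_ ∷ a≢c ∷ _) ∷ _) (here refl) _ _ =
    a , c , a≢c , ab , Adj-sym bc
  interior⇒two-neighbours a (b ∷ L) (_ , chain) (_ ∷ unique) (there v∈L) (there ends) v≢e =
    interior⇒two-neighbours b L chain unique v∈L ends v≢e

  last⇒neighbour : ∀ a b L {e} → Chain D (a ∷ b ∷ L) → EndsIn D (b ∷ L) e →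
    ∃ λ p → p ∈ₗ (a ∷ b ∷ L) × Adj D p e
  last⇒neighbour a b [] (ab , _) (here _) = a , here refl , ab
  last⇒neighbour a b [] _ (there ())
  last⇒neighbour a b (c ∷ L) (_ , chain) (there ends) =
    let p , p∈ , pe = last⇒neighbour b c L chain ends in p , there p∈ , pe

  cycle⇒two-neighbours : ∀ {cs v} → IsCycle D cs → v ∈ₗ cs →
    ∃₂ λ p q → p ≢ q × Adj D p v × Adj D q v
  cycle⇒two-neighbours {x ∷ y ∷ z ∷ zs} (_ ∷ (y∉ ∷ _) , (xy , _) , w , ends , wx) (here refl) =
    y , w , All.lookup y∉ (EndsIn⇒∈ ends) , Adj-sym xy , wx
  cycle⇒two-neighbours {x ∷ y ∷ z ∷ zs} {v} (x∉ ∷ unique , (xy , chain) , w , ends , wx) (there v∈)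
    with v ≟ w
  ... | no  v≢w = interior⇒two-neighbours x (y ∷ z ∷ zs) (xy , chain) (x∉ ∷ unique) v∈
                    (there (there ends)) v≢w
  ... | yes refl = let p , p∈ , pw = last⇒neighbour y z zs chain ends
                   in x , p , All.lookup x∉ p∈ , Adj-sym wx , pw

  pendant∉cycle : ∀ {v c} → (∀ u → Adj D u v → u ≡ c) → ∀ {cs} → IsCycle D cs → v ∉ₗ cs
  pendant∉cycle only cycle v∈ with cycle⇒two-neighbours cycle v∈
  ... | p , q , p≢q , pv , qv = p≢q (trans (only p pv) (sym (only q qv)))

∉zero⇒map-suc : ∀ {k} (L : List (Fin (suc k))) → zero ∉ₗ L → ∃ λ L' → map suc L' ≡ L
∉zero⇒map-suc [] _ = [] , refl
∉zero⇒map-suc (zero ∷ L) zero∉ = contradiction (here refl) zero∉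
∉zero⇒map-suc (suc x ∷ L) zero∉ =
  let L' , eq = ∉zero⇒map-suc L (zero∉ ∘ there) in x ∷ L' , cong (suc x ∷_) eq

minimal-extension : ∀ {k} {D' : Digraph k} {D : Digraph (suc k)} →
  (∀ S → IsOLD D' S → k ≤ ∣ S ∣) →
  (∀ h S → IsOLD D (h ∷ S) → h ≡ true × IsOLD D' S) →
  ∀ S → IsOLD D S → suc k ≤ ∣ S ∣
minimal-extension minimal restrict (h ∷ S) old with restrict h S old
... | refl , old' = s≤s (minimal S old')

module PendantExtension {k : ℕ} (D' : Digraph k) (D : Digraph (suc k))
  (restricts : ∀ x y → D (suc x) (suc y) ≡ D' x y) (b : Fin k)
  (new-adj : Adj D zero (suc b)) (new-pendant : ∀ u → Adj D u zero → u ≡ suc b) where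

  Adj-suc⁺ : ∀ {x y} → Adj D' x y → Adj D (suc x) (suc y)
  Adj-suc⁺ {x} {y} (x≢y , inj₁ xy) = x≢y ∘ suc-injective , inj₁ (trans (restricts x y) xy)
  Adj-suc⁺ {x} {y} (x≢y , inj₂ yx) = x≢y ∘ suc-injective , inj₂ (trans (restricts y x) yx)

  Adj-suc⁻ : ∀ {x y} → Adj D (suc x) (suc y) → Adj D' x y
  Adj-suc⁻ {x} {y} (x≢y , inj₁ xy) = x≢y ∘ cong suc , inj₁ (trans (sym (restricts x y)) xy)
  Adj-suc⁻ {x} {y} (x≢y , inj₂ yx) = x≢y ∘ cong suc , inj₂ (trans (sym (restricts y x)) yx)

  Chain-suc⁺ : ∀ xs → Chain D' xs → Chain D (map suc xs)
  Chain-suc⁺ [] _ = tt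
  Chain-suc⁺ (_ ∷ []) _ = tt
  Chain-suc⁺ (_ ∷ y ∷ xs) (adj , chain) = Adj-suc⁺ adj , Chain-suc⁺ (y ∷ xs) chain

  Chain-suc⁻ : ∀ xs → Chain D (map suc xs) → Chain D' xs
  Chain-suc⁻ [] _ = tt
  Chain-suc⁻ (_ ∷ []) _ = tt
  Chain-suc⁻ (_ ∷ y ∷ xs) (adj , chain) = Adj-suc⁻ adj , Chain-suc⁻ (y ∷ xs) chain

  EndsIn-suc⁺ : ∀ {xs y} → EndsIn D' xs y → EndsIn D (map suc xs) (suc y)
  EndsIn-suc⁺ (here y) = here (suc y)
  EndsIn-suc⁺ (there ends) = there (EndsIn-suc⁺ ends)

  EndsIn-suc⁻ : ∀ xs {w} → EndsIn D (map suc xs) w → ∃ λ w' → w ≡ suc w' × EndsIn D' xs w'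
  EndsIn-suc⁻ (x ∷ []) (here _) = x , refl , here x
  EndsIn-suc⁻ (x ∷ []) (there ())
  EndsIn-suc⁻ (x ∷ y ∷ xs) (there ends) =
    let w' , eq , ends' = EndsIn-suc⁻ (y ∷ xs) ends in w' , eq , there ends'

  Walk-suc : ∀ {x y} → Walk D' x y → Walk D (suc x) (suc y)
  Walk-suc {x} (xs , chain , ends) = map suc xs , Chain-suc⁺ (x ∷ xs) chain , EndsIn-suc⁺ ends

  IsCycle-suc⁻ : ∀ xs → IsCycle D (map suc xs) → IsCycle D' xs
  IsCycle-suc⁻ (x ∷ y ∷ z ∷ zs) (unique , chain , w , ends , wx) with EndsIn-suc⁻ (z ∷ zs) ends
  ... | w' , refl , ends' =
    map⁻ unique , Chain-suc⁻ (x ∷ y ∷ z ∷ zs) chain , w' , ends' , Adj-suc⁻ wx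

  dominating : D zero zero ≡ true → Dominating D' → Dominating D
  dominating loop dom zero    = zero , loop
  dominating loop dom (suc y) = let u , uy = dom y in suc u , trans (restricts u y) uy

  connected : Connected D' → Connected D
  connected conn zero    zero    = walk-refl D zero
  connected conn zero    (suc y) = walk-cons D new-adj (Walk-suc (conn b y))
  connected conn (suc x) zero    =
    walk-trans D (Walk-suc (conn x b)) (walk-cons D (Adj-sym D new-adj) (walk-refl D zero))
  connected conn (suc x) (suc y) = Walk-suc (conn x y)

  acyclic : Acyclic D' → Acyclic D
  acyclic acyc cs cycle with any? (zero ≟_) cs
  ... | yes zero∈ = pendant∉cycle D new-pendant cycle zero∈
  ... | no  zero∉ with ∉zero⇒map-suc cs zero∉
  ...   | cs' , refl = acyc cs' (IsCycle-suc⁻ cs' cycle)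

  InT-extension : InT k D' → Dominating D → Separating D →
    (∀ h S → IsOLD D (h ∷ S) → h ≡ true × IsOLD D' S) → InT (suc k) D
  InT-extension (_ , (_ , minimal) , conn , acyc) dom sep restrict =
    (⊤ , full) , ((⊤ , full , ∣⊤∣≡n (suc k)) , minimal-extension minimal restrict)
    , connected conn , acyclic acyc
    where
    full : IsOLD D ⊤
    full = ⊤-isOLD D dom sep

module RuleI {k : ℕ} (D' : Digraph k) (b : Fin k) where

  D : Digraph (suc k)
  D = ruleI D' b

  new-adj : Adj D zero (suc b)
  new-adj = (λ ()) , inj₂ (≡⇒⌊≟⌋≡true refl)

  new-pendant : ∀ u → Adj D u zero → u ≡ suc b
  new-pendant zero    (u≢zero , _) = contradiction refl u≢zero
  new-pendant (suc t) (_ , inj₁ tb) = cong suc (⌊≟⌋≡true⇒≡ tb)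

  open PendantExtension D' D (λ _ _ → refl) b new-adj new-pendant using (dominating; InT-extension)

  separating : Separating D' → Separating D
  separating sep zero    zero    z≢z = contradiction refl z≢z
  separating sep zero    (suc y) _   = zero , refl
  separating sep (suc x) zero    _   = zero , refl
  separating sep (suc x) (suc y) x≢y = let w , w-sep = sep x y (x≢y ∘ cong suc) in suc w , w-sep

  -- If N⁻(w) = {b}, then N⁻(a) ⊖ N⁻(w) = {a}.
  new∈OLD : DomForced D' b → ∀ h S → IsOLD D (h ∷ S) → h ≡ true
  new∈OLD (w , N⁻w≡b) h S (_ , sep) with sep zero (suc w) (λ ())
  ... | zero  , here , _     = refl
  ... | suc t , _    , t-sep = contradiction
    (trans (sym t-sep)
      (trans (cong (⌊ t ≟ b ⌋ xor_) (indicator-of-singleton N⁻w≡b t)) (xor-same ⌊ t ≟ b ⌋)))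
    λ ()

  OLD-restrict : ∀ h S → IsOLD D (h ∷ S) → IsOLD D' S
  OLD-restrict h S (dom , sep) = dom' , sep'
    where
    dom' : ∀ y → ∃ λ u → u ∈ S × D' u y ≡ true
    dom' y with dom (suc y)
    ... | suc u , there u∈S , uy = u , u∈S , uy

    sep' : ∀ u v → u ≢ v → ∃ λ w → w ∈ S × (D' w u xor D' w v) ≡ true
    sep' u v u≢v with sep (suc u) (suc v) (u≢v ∘ suc-injective)
    ... | suc w , there w∈S , w-sep = w , w∈S , w-sep

  InT-ruleI : InT k D' → DomForced D' b → InT (suc k) D
  InT-ruleI t@(loc , _) forced =
    InT-extension t (dominating refl (Locatable⇒Dominating D' loc))
      (separating (Locatable⇒Separating D' loc))
      (λ h S old → new∈OLD forced h S old , OLD-restrict h S old)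

module RuleII {k : ℕ} (D' : Digraph k) (b : Fin k) where

  D : Digraph (suc k)
  D = ruleII D' b

  new-adj : Adj D zero (suc b)
  new-adj = (λ ()) , inj₁ (≡⇒⌊≟⌋≡true refl)

  new-pendant : ∀ u → Adj D u zero → u ≡ suc b
  new-pendant zero    (u≢zero , _) = contradiction refl u≢zero
  new-pendant (suc t) (_ , inj₂ bt) = cong suc (⌊≟⌋≡true⇒≡ bt)

  open PendantExtension D' D (λ _ _ → refl) b new-adj new-pendant using (dominating; InT-extension)

  separates-new : Dominating D' → ∀ y → ∃ λ w → (D w zero xor D w (suc y)) ≡ true
  separates-new dom y with y ≟ b
  ... | yes refl = let u , uy = dom y in suc u , uy
  ... | no  y≢b  = zero , cong not (≢⇒⌊≟⌋≡false y≢b)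

  separating : Dominating D' → Separating D' → Separating D
  separating dom sep zero    zero    z≢z = contradiction refl z≢z
  separating dom sep zero    (suc y) _   = separates-new dom y
  separating dom sep (suc x) zero    _   =
    let w , w-sep = separates-new dom x in w , trans (xor-comm (D w (suc x)) (D w zero)) w-sep
  separating dom sep (suc x) (suc y) x≢y = let w , w-sep = sep x y (x≢y ∘ cong suc) in suc w , w-sep

  new∈OLD : ∀ h S → IsOLD D (h ∷ S) → h ≡ true
  new∈OLD h S (dom , _) with dom zero
  ... | zero , here , _ = refl

  module _ {x : Fin k} (xb : D' x b ≡ true) (outdeg≡1 : outdeg D' x ≡ 1)
           (forced : DomForced D' x) where

    N⁺x≡b : ∀ v → (D' x v ≡ true) ⇔ (v ≡ b)
    N⁺x≡b v = mk⇔ (λ xv → outdeg≡1⇒out-unique D' outdeg≡1 xv xb) (λ { refl → xb })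

    -- The vertex w with N⁻(w) = {x} is an out-neighbour of x, hence w = b.
    N⁻b≡x : ∀ u → (D' u b ≡ true) ⇔ (u ≡ x)
    N⁻b≡x = let w , N⁻w≡x = forced in
      subst (λ z → ∀ u → (D' u z ≡ true) ⇔ (u ≡ x))
            (Equivalence.to (N⁺x≡b w) (Equivalence.from (N⁻w≡x x) refl)) N⁻w≡x

    x∈OLD : ∀ h S → IsOLD D (h ∷ S) → x ∈ S
    x∈OLD h S (_ , sep) with sep zero (suc b) (λ ())
    ... | zero  , _ , a-sep = contradiction (sym a-sep) (not-¬ (sym (≡⇒⌊≟⌋≡true refl)))
    ... | suc t , there t∈S , tb = subst (_∈ S) (Equivalence.to (N⁻b≡x t) tb) t∈S

    OLD-restrict : ∀ h S → IsOLD D (h ∷ S) → IsOLD D' S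
    OLD-restrict h S old@(dom , sep) = dom' , sep'
      where
      x-row : ∀ v → D' x v ≡ ⌊ v ≟ b ⌋
      x-row = indicator-of-singleton N⁺x≡b

      dom' : ∀ y → ∃ λ u → u ∈ S × D' u y ≡ true
      dom' y with dom (suc y)
      ... | zero  , _         , ay = x , x∈OLD h S old , trans (x-row y) ay
      ... | suc u , there u∈S , uy = u , u∈S , uy

      sep' : ∀ u v → u ≢ v → ∃ λ w → w ∈ S × (D' w u xor D' w v) ≡ true
      sep' u v u≢v with sep (suc u) (suc v) (u≢v ∘ suc-injective)
      ... | zero  , _         , a-sep =
        x , x∈OLD h S old , trans (cong₂ _xor_ (x-row u) (x-row v)) a-sep
      ... | suc w , there w∈S , w-sep = w , w∈S , w-sep

  InT-ruleII : InT k D' → (∃ λ x → ForcingArc D' x b × outdeg D' x ≡ 1 × DomForced D' x) →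
    InT (suc k) D
  InT-ruleII t@(loc , _) (x , (xb , _) , outdeg≡1 , forced) =
    InT-extension t (dominating refl dom) (separating dom (Locatable⇒Separating D' loc))
      (λ h S old → new∈OLD h S old , OLD-restrict xb outdeg≡1 forced h S old)
    where
    dom : Dominating D'
    dom = Locatable⇒Dominating D' loc

lemma4p7 : (k : ℕ) → 1 ≤ k → (D' : Digraph k) → InT k D' → (b : Fin k) →
    (DomForced D' b → InT (suc k) (ruleI D' b)) ×
    (D' b b ≡ false →
      (∃ λ x → ForcingArc D' x b × outdeg D' x ≡ 1 × DomForced D' x) →
      InT (suc k) (ruleII D' b))
lemma4p7 k _ D' t b = RuleI.InT-ruleI D' b t , λ _ → RuleII.InT-ruleII D' b t
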